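{- Let $t \geq 3$ be an integer, let $G$ be a $\{P_6, K_{2,t}\}$-free graph, and let $\Pi$ be an induced subgraph of $G$ that is a pyramid with apex $a$ such that $\Pi$ is simplicial in $G$. Then for every $\Pi$-basic vertex $b \in V(G) \setminus V(\Pi)$ there exists an $(a,b)$-separator $S$ in $G$ with $\alpha(S) \leq 2(t-1)+3$.
   Context: All graphs are finite and simple; $P_6$ is the path on $6$ vertices and $K_{2,t}$ the complete bipartite graph with parts of sizes $2$ and $t$; $\{P_6,K_{2,t}\}$-free means no induced subgraph isomorphic to either. A pyramid is the graph on vertices $a,x_1,x_2,x_3,y_1,y_2,y_3$ with edges $ax_i$, $x_iy_i$ ($i\in[3]$) and $y_iy_j$ ($i\neq j$); $a$ is its apex and $\{y_1,y_2,y_3\}$ its base. An induced pyramid $\Pi$ is simplicial in $G$ if for every $v \in V(G)\setminus V(\Pi)$ the set $N_G(v)\cap V(\Pi)$ is a nonempty clique; a vertex $v \in V(G)\setminus V(\Pi)$ is $\Pi$-basic if $N_G(v)\cap V(\Pi)$ equals the base of $\Pi$. For vertices $u,v$, a $(u,v)$-separator is a set $S\subseteq V(G)\setminus\{u,v\}$ intersecting every path in $G$ from $u$ to $v$. $\alpha(S)$ is the maximum size of an independent set of $G$ contained in $S$. -}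

module Defs where

open import Data.Nat using (ℕ; suc; _+_; _*_; _∸_; _≤_)
open import Data.Fin using (Fin; toℕ; zero; suc; _↑ˡ_; _↑ʳ_)
open import Data.Fin.Subset using (Subset; _∈_; _∉_; _⊆_; ∣_∣)
open import Data.List using (List; []; _∷_; head; last)
open import Data.List.Relation.Unary.AllPairs using (AllPairs)
open import Data.List.Relation.Unary.Any using (Any)
open import Data.List.Relation.Unary.Unique.Propositional using (Unique)
open import Data.Maybe using (just)
open import Data.Product using (Σ; ∃; _×_; _,_)
open import Data.Sum using (_⊎_)
open import Data.Empty using (⊥)
open import Function using (Injective)
open import Relation.Binary.PropositionalEquality using (_≡_; _≢_)
open import Relation.Nullary using (¬_; Dec)

record Graph : Set₁ where
  field
    n    : ℕ
    Adj  : Fin n → Fin n → Set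
    sym  : ∀ {u v} → Adj u v → Adj v u
    irr  : ∀ {v} → ¬ Adj v v
    dec  : ∀ u v → Dec (Adj u v)
open Graph public

Vtx : Graph → Set
Vtx G = Fin (n G)

record InducedCopy (H G : Graph) : Set where
  field
    emb  : Vtx H → Vtx G
    inj  : Injective _≡_ _≡_ emb
    adj⇔ : ∀ i j → (Adj H i j → Adj G (emb i) (emb j)) × (Adj G (emb i) (emb j) → Adj H i j)
open InducedCopy public

_Free_ : Graph → Graph → Set
G Free H = ¬ InducedCopy H G

∣_-_∣ : ℕ → ℕ → ℕ
∣ a - b ∣ = (a ∸ b) + (b ∸ a)

P6 : Graph
P6 = record
  { n = 6
  ; Adj = λ i j → ∣ toℕ i - toℕ j ∣ ≡ 1
  ; sym = λ {u} {v} → symP {u} {v} ; irr = λ {v} → irrP {v} ; dec = λ i j → ∣ toℕ i - toℕ j ∣ Data.Nat.≟ 1 }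
  where
  open import Data.Nat.Properties using (+-comm; n∸n≡0)
  open import Relation.Binary.PropositionalEquality using (trans)
  import Data.Nat
  symP : ∀ {u v : Fin 6} → ∣ toℕ u - toℕ v ∣ ≡ 1 → ∣ toℕ v - toℕ u ∣ ≡ 1
  symP {u} {v} e = trans (+-comm (toℕ v ∸ toℕ u) (toℕ u ∸ toℕ v)) e
  irrP : ∀ {v : Fin 6} → ¬ (∣ toℕ v - toℕ v ∣ ≡ 1)
  irrP {v} e with toℕ v ∸ toℕ v | n∸n≡0 (toℕ v)
  irrP {v} () | .0 | _≡_.refl

Side : ∀ {t} → Fin (2 + t) → Set
Side i = toℕ i Data.Nat.< 2
  where import Data.Nat

K2 : ℕ → Graph
K2 t = record
  { n = 2 + t
  ; Adj = λ i j → (Side {t} i × ¬ Side {t} j) ⊎ (¬ Side {t} i × Side {t} j)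
  ; sym = λ { (Data.Sum.inj₁ (a , b)) → Data.Sum.inj₂ (b , a)
            ; (Data.Sum.inj₂ (a , b)) → Data.Sum.inj₁ (b , a) }
  ; irr = λ { (Data.Sum.inj₁ (a , b)) → b a ; (Data.Sum.inj₂ (a , b)) → a b }
  ; dec = λ i j → (Side? i ×-dec ¬? (Side? j)) ⊎-dec (¬? (Side? i) ×-dec Side? j) }
  where
  import Data.Sum
  import Data.Nat
  open import Relation.Nullary using (¬?)
  open import Relation.Nullary.Decidable using (_×-dec_; _⊎-dec_)
  Side? : (i : Fin (2 + t)) → Dec (Side {t} i)
  Side? i = suc (toℕ i) Data.Nat.≤? 2

-- The pyramid graph.  Vertex numbering: 0 = a (apex), 1,2,3 = x₁,x₂,x₃,
-- 4,5,6 = y₁,y₂,y₃ (the base).  Edges: a xᵢ, xᵢ yᵢ, yᵢ yⱼ (i ≠ j).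
PyrEdge : ℕ → ℕ → Set
PyrEdge i j =
  (i ≡ 0 × (j ≡ 1 ⊎ j ≡ 2 ⊎ j ≡ 3)) ⊎
  (i ≡ 1 × j ≡ 4) ⊎ (i ≡ 2 × j ≡ 5) ⊎ (i ≡ 3 × j ≡ 6) ⊎
  (i ≡ 4 × j ≡ 5) ⊎ (i ≡ 4 × j ≡ 6) ⊎ (i ≡ 5 × j ≡ 6)

PyrAdj : Fin 7 → Fin 7 → Set
PyrAdj i j = PyrEdge (toℕ i) (toℕ j) ⊎ PyrEdge (toℕ j) (toℕ i)

private
  open import Data.Fin.Properties using (_≟_)
  open import Relation.Nullary.Decidable using (_×-dec_; _⊎-dec_)
  import Data.Nat as N
  PyrEdge? : ∀ i j → Dec (PyrEdge i j)
  PyrEdge? i j =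
    ((i N.≟ 0) ×-dec ((j N.≟ 1) ⊎-dec (j N.≟ 2) ⊎-dec (j N.≟ 3))) ⊎-dec
    ((i N.≟ 1) ×-dec (j N.≟ 4)) ⊎-dec ((i N.≟ 2) ×-dec (j N.≟ 5)) ⊎-dec
    ((i N.≟ 3) ×-dec (j N.≟ 6)) ⊎-dec ((i N.≟ 4) ×-dec (j N.≟ 5)) ⊎-dec
    ((i N.≟ 4) ×-dec (j N.≟ 6)) ⊎-dec ((i N.≟ 5) ×-dec (j N.≟ 6))

  pyrIrr : ∀ i → ¬ PyrEdge i i
  pyrIrr i (Data.Sum.inj₁ (_≡_.refl , Data.Sum.inj₁ ()))
  pyrIrr i (Data.Sum.inj₁ (_≡_.refl , Data.Sum.inj₂ (Data.Sum.inj₁ ())))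
  pyrIrr i (Data.Sum.inj₁ (_≡_.refl , Data.Sum.inj₂ (Data.Sum.inj₂ ())))
  pyrIrr i (Data.Sum.inj₂ (Data.Sum.inj₁ (_≡_.refl , ())))
  pyrIrr i (Data.Sum.inj₂ (Data.Sum.inj₂ (Data.Sum.inj₁ (_≡_.refl , ()))))
  pyrIrr i (Data.Sum.inj₂ (Data.Sum.inj₂ (Data.Sum.inj₂ (Data.Sum.inj₁ (_≡_.refl , ())))))
  pyrIrr i (Data.Sum.inj₂ (Data.Sum.inj₂ (Data.Sum.inj₂ (Data.Sum.inj₂ (Data.Sum.inj₁ (_≡_.refl , ()))))))
  pyrIrr i (Data.Sum.inj₂ (Data.Sum.inj₂ (Data.Sum.inj₂ (Data.Sum.inj₂ (Data.Sum.inj₂ (Data.Sum.inj₁ (_≡_.refl , ())))))))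
  pyrIrr i (Data.Sum.inj₂ (Data.Sum.inj₂ (Data.Sum.inj₂ (Data.Sum.inj₂ (Data.Sum.inj₂ (Data.Sum.inj₂ (_≡_.refl , ())))))))

Pyramid : Graph
Pyramid = record
  { n = 7
  ; Adj = PyrAdj
  ; sym = λ { (Data.Sum.inj₁ e) → Data.Sum.inj₂ e ; (Data.Sum.inj₂ e) → Data.Sum.inj₁ e }
  ; irr = λ { {v} (Data.Sum.inj₁ e) → pyrIrr (toℕ v) e ; {v} (Data.Sum.inj₂ e) → pyrIrr (toℕ v) e }
  ; dec = λ i j → PyrEdge? (toℕ i) (toℕ j) ⊎-dec PyrEdge? (toℕ j) (toℕ i) }
  where import Data.Sum

apexIx : Fin 7
apexIx = zero

InBase : Fin 7 → Set
InBase i = 4 ≤ toℕ i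

InPyr : ∀ {G} → InducedCopy Pyramid G → Vtx G → Set
InPyr Π v = ∃ λ i → emb Π i ≡ v

apex : ∀ {G} → InducedCopy Pyramid G → Vtx G
apex Π = emb Π apexIx

Simplicial : (G : Graph) → InducedCopy Pyramid G → Set
Simplicial G Π = ∀ v → ¬ InPyr Π v →
  (∃ λ i → Adj G v (emb Π i)) ×
  (∀ i j → Adj G v (emb Π i) → Adj G v (emb Π j) → i ≢ j → Adj G (emb Π i) (emb Π j))

Basic : (G : Graph) → InducedCopy Pyramid G → Vtx G → Set
Basic G Π v = ¬ InPyr Π v ×
  (∀ i → (Adj G v (emb Π i) → InBase i) × (InBase i → Adj G v (emb Π i)))

data Chain (G : Graph) : List (Vtx G) → Set where
  []  : Chain G []
  [_] : ∀ x → Chain G (x ∷ [])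
  _∷_ : ∀ {x y xs} → Adj G x y → Chain G (y ∷ xs) → Chain G (x ∷ y ∷ xs)

record Path (G : Graph) (u v : Vtx G) : Set where
  field
    verts  : List (Vtx G)
    chain  : Chain G verts
    distinct : Unique verts
    start  : head verts ≡ just u
    end    : last verts ≡ just v
open Path public

Separator : (G : Graph) → Vtx G → Vtx G → Subset (n G) → Set
Separator G u v S = u ∉ S × v ∉ S ×
  ((P : Path G u v) → Any (λ w → w ∈ S) (verts P))

Independent : (G : Graph) → Subset (n G) → Set
Independent G I = ∀ x y → x ∈ I → y ∈ I → ¬ Adj G x y

αLe : (G : Graph) → Subset (n G) → ℕ → Set
αLe G S k = ∀ I → I ⊆ S → Independent G I → ∣ I ∣ ≤ k

-- Write x₀, x₁, x₂ for the neighbours of the apex a and y₀, y₁, y₂ for the base, and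
-- let S = {x₀, x₁, x₂} ∪ R ∪ Q, where R is the common neighbourhood of a and b, and Q
-- consists of the vertices other than b, outside Π ∪ N[a], that have a neighbour in
-- N(a) ∖ Π.  A path from a to b leaves N[a] along an edge uw: if u ∈ Π then u is some
-- xⱼ, if w = b then u ∈ R, and otherwise w ∈ Q (simpliciality keeps w out of Π).
-- An independent set meets {x₀, x₁, x₂} at most three times and R at most t − 1 times,
-- since a, b and t independent common neighbours induce K_{2,t}.  For Q, P6-freeness
-- and simpliciality force every vertex of Q to see y₀, and every v ∈ N(a) ∖ Π seeing
-- one vertex of an independent subset of Q to see all of it; so that subset lies in
-- the common neighbourhood of the non-adjacent pair v, y₀ and has fewer than t elements.

module Submission where

open import Defs renaming (sym to Adj-sym; irr to Adj-irrefl; dec to Adj?)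
open import Level using (Level)
open import Data.Bool using (true; false)
open import Data.Empty using (⊥-elim)
open import Data.Fin using (Fin; zero; suc; _↑ˡ_; _↑ʳ_)
open import Data.Fin.Patterns using (0F; 1F; 2F; 3F; 4F; 5F; 6F)
open import Data.Fin.Properties using (suc-injective; all?; any?) renaming (_≟_ to _≟ᶠ_)
open import Data.Fin.Subset using (Subset; inside; outside; _∈_; _∉_; _⊆_; _∪_; _∩_; ⁅_⁆; ∣_∣)
open import Data.Fin.Subset.Properties
  using (p⊆q⇒∣p∣≤∣q∣; x∈p∩q⁺; p∩q⊆p; p∩q⊆q; ∣p∩q∣≤∣q∣; ∩-distribˡ-∪; x∈p∪q⁺; x∈p∪q⁻;
         x∈⁅x⁆; x∈⁅y⁆⇒x≡y; ∣⁅x⁆∣≡1; nonempty?; Empty-unique; ∣⊥∣≡0)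
open import Data.List using (_∷_; last)
open import Data.List.Relation.Unary.Any using (Any; here; there)
open import Data.Maybe using (just)
open import Data.Maybe.Properties using (just-injective)
open import Data.Nat using (ℕ; zero; suc; _≤_; _<_; _+_; _*_; _∸_; z≤n; s≤s; s≤s⁻¹; _≤?_)
open import Data.Nat.Properties
  using (≤-trans; ≤-reflexive; +-suc; +-comm; +-identityʳ; +-mono-≤; +-monoʳ-≤; n≤1+n; ≰⇒>; <⇒≤pred;
         module ≤-Reasoning)
open import Data.Product using (Σ; ∃; _×_; _,_; proj₁; proj₂)
open import Data.Sum as Sum using (_⊎_; inj₁; inj₂; [_,_]′)
open import Data.Vec using ([]; _∷_; tabulate; lookup; here; there)
open import Data.Vec.Properties using (lookup∘tabulate; []=⇒lookup; lookup⇒[]=)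
open import Function using (Injective; _∘_; case_of_)
open import Relation.Binary.PropositionalEquality
  using (_≡_; _≢_; refl; sym; trans; cong; cong₂; subst; module ≡-Reasoning)
open import Relation.Nullary using (¬_; yes; no; does; ¬?; contradiction)
open import Relation.Nullary.Decidable using (dec-true; dec-false; decidable-stable; from-yes; _×-dec_; _⊎-dec_; _→-dec_)
open import Relation.Unary using (Pred; Decidable)

private variable
  ℓ : Level
  m : ℕ

-- Subsets of Fin m and their sizes

fromDec : {P : Pred (Fin m) ℓ} → Decidable P → Subset m
fromDec P? = tabulate (does ∘ P?)

module _ {P : Pred (Fin m) ℓ} (P? : Decidable P) where

  ∈-fromDec⁺ : ∀ {x} → P x → x ∈ fromDec P?
  ∈-fromDec⁺ {x} p = lookup⇒[]= x _ (trans (lookup∘tabulate _ x) (dec-true (P? x) p))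

  ∈-fromDec⁻ : ∀ {x} → x ∈ fromDec P? → P x
  ∈-fromDec⁻ {x} x∈ = decidable-stable (P? x) λ ¬p → true≢false (begin
    true                  ≡⟨ sym ([]=⇒lookup x∈) ⟩
    lookup (fromDec P?) x ≡⟨ lookup∘tabulate _ x ⟩
    does (P? x)           ≡⟨ dec-false (P? x) ¬p ⟩
    false                 ∎)
    where
    open ≡-Reasoning
    true≢false : true ≢ false
    true≢false ()

∣p∪q∣≤∣p∣+∣q∣ : (p q : Subset m) → ∣ p ∪ q ∣ ≤ ∣ p ∣ + ∣ q ∣
∣p∪q∣≤∣p∣+∣q∣ []            []            = z≤n
∣p∪q∣≤∣p∣+∣q∣ (inside ∷ p)  (inside ∷ q)  = s≤s (≤-trans (∣p∪q∣≤∣p∣+∣q∣ p q) (+-monoʳ-≤ ∣ p ∣ (n≤1+n ∣ q ∣)))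
∣p∪q∣≤∣p∣+∣q∣ (inside ∷ p)  (outside ∷ q) = s≤s (∣p∪q∣≤∣p∣+∣q∣ p q)
∣p∪q∣≤∣p∣+∣q∣ (outside ∷ p) (inside ∷ q)  = ≤-trans (s≤s (∣p∪q∣≤∣p∣+∣q∣ p q)) (≤-reflexive (sym (+-suc ∣ p ∣ ∣ q ∣)))
∣p∪q∣≤∣p∣+∣q∣ (outside ∷ p) (outside ∷ q) = ∣p∪q∣≤∣p∣+∣q∣ p q

⊆∪⇒∣p∣≤∣p∩q∣+∣p∩r∣ : (p q r : Subset m) → p ⊆ q ∪ r → ∣ p ∣ ≤ ∣ p ∩ q ∣ + ∣ p ∩ r ∣
⊆∪⇒∣p∣≤∣p∩q∣+∣p∩r∣ p q r p⊆q∪r = begin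
  ∣ p ∣                 ≤⟨ p⊆q⇒∣p∣≤∣q∣ (λ x∈p → x∈p∩q⁺ (x∈p , p⊆q∪r x∈p)) ⟩
  ∣ p ∩ (q ∪ r) ∣       ≡⟨ cong ∣_∣ (∩-distribˡ-∪ p q r) ⟩
  ∣ p ∩ q ∪ p ∩ r ∣     ≤⟨ ∣p∪q∣≤∣p∣+∣q∣ (p ∩ q) (p ∩ r) ⟩
  ∣ p ∩ q ∣ + ∣ p ∩ r ∣ ∎
  where open ≤-Reasoning

t≤∣p∣⇒embedding : ∀ t (p : Subset m) → t ≤ ∣ p ∣ →
  Σ (Fin t → Fin m) λ f → Injective _≡_ _≡_ f × (∀ i → f i ∈ p)
t≤∣p∣⇒embedding zero    p             _     = (λ ()) , (λ {}) , (λ ())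
t≤∣p∣⇒embedding (suc t) (inside ∷ p)  t<∣p∣
  with f , f-inj , f∈p ← t≤∣p∣⇒embedding t p (s≤s⁻¹ t<∣p∣) = g , g-inj , g∈
  where
  g : Fin (suc t) → Fin _
  g zero    = zero
  g (suc i) = suc (f i)
  g-inj : Injective _≡_ _≡_ g
  g-inj {zero}  {zero}  _  = refl
  g-inj {suc i} {suc j} eq = cong suc (f-inj (suc-injective eq))
  g∈ : ∀ i → g i ∈ inside ∷ p
  g∈ zero    = here
  g∈ (suc i) = there (f∈p i)
t≤∣p∣⇒embedding (suc t) (outside ∷ p) t<∣p∣
  with f , f-inj , f∈p ← t≤∣p∣⇒embedding (suc t) p t<∣p∣ =
  suc ∘ f , f-inj ∘ suc-injective , there ∘ f∈p

-- Independent sets, induced copies and paths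

module _ {G : Graph} where

  private
    V : Set
    V = Vtx G

  Independent-⊆ : ∀ {I J} → J ⊆ I → Independent G I → Independent G J
  Independent-⊆ J⊆I ind x y x∈J y∈J = ind x y (J⊆I x∈J) (J⊆I y∈J)

  ≢-by-neighbour : ∀ {u v w : V} → Adj G u w → ¬ Adj G v w → u ≢ v
  ≢-by-neighbour uw ¬vw refl = ¬vw uw

  K2-copy : ∀ {t} {p q : V} (f : Fin t → V) → p ≢ q → ¬ Adj G p q → Injective _≡_ _≡_ f →
    (∀ i → Adj G (f i) p × Adj G (f i) q) → (∀ i j → ¬ Adj G (f i) (f j)) → InducedCopy (K2 t) G
  K2-copy {t} {p} {q} f p≢q p≁q f-inj f∼pq f-indep = record
    { emb = w ; inj = w-inj ; adj⇔ = λ i j → preserve i j , reflect i j }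
    where
    w : Fin (2 + t) → V
    w 0F            = p
    w 1F            = q
    w (suc (suc i)) = f i

    0-side : Side {t} 0F
    0-side = s≤s z≤n
    1-side : Side {t} 1F
    1-side = s≤s (s≤s z≤n)
    ¬side : ∀ i → ¬ Side {t} (suc (suc i))
    ¬side i (s≤s (s≤s ()))

    preserve : ∀ i j → Adj (K2 t) i j → Adj G (w i) (w j)
    preserve 0F            (suc (suc j)) _                = Adj-sym G (proj₁ (f∼pq j))
    preserve 1F            (suc (suc j)) _                = Adj-sym G (proj₂ (f∼pq j))
    preserve (suc (suc i)) 0F            _                = proj₁ (f∼pq i)
    preserve (suc (suc i)) 1F            _                = proj₂ (f∼pq i)
    preserve 0F            0F            (inj₁ (_ , ¬s))  = contradiction 0-side ¬s
    preserve 0F            0F            (inj₂ (¬s , _))  = contradiction 0-side ¬s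
    preserve 0F            1F            (inj₁ (_ , ¬s))  = contradiction 1-side ¬s
    preserve 0F            1F            (inj₂ (¬s , _))  = contradiction 0-side ¬s
    preserve 1F            0F            (inj₁ (_ , ¬s))  = contradiction 0-side ¬s
    preserve 1F            0F            (inj₂ (¬s , _))  = contradiction 1-side ¬s
    preserve 1F            1F            (inj₁ (_ , ¬s))  = contradiction 1-side ¬s
    preserve 1F            1F            (inj₂ (¬s , _))  = contradiction 1-side ¬s
    preserve (suc (suc i)) (suc (suc j)) (inj₁ (s , _))   = contradiction s (¬side i)
    preserve (suc (suc i)) (suc (suc j)) (inj₂ (_ , s))   = contradiction s (¬side j)

    reflect : ∀ i j → Adj G (w i) (w j) → Adj (K2 t) i j
    reflect 0F            0F            h = contradiction h (Adj-irrefl G)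
    reflect 1F            1F            h = contradiction h (Adj-irrefl G)
    reflect 0F            1F            h = contradiction h p≁q
    reflect 1F            0F            h = contradiction (Adj-sym G h) p≁q
    reflect 0F            (suc (suc j)) _ = inj₁ (0-side , ¬side j)
    reflect 1F            (suc (suc j)) _ = inj₁ (1-side , ¬side j)
    reflect (suc (suc i)) 0F            _ = inj₂ (¬side i , 0-side)
    reflect (suc (suc i)) 1F            _ = inj₂ (¬side i , 1-side)
    reflect (suc (suc i)) (suc (suc j)) h = contradiction h (f-indep i j)

    w-inj : Injective _≡_ _≡_ w
    w-inj {0F}          {0F}          _  = refl
    w-inj {1F}          {1F}          _  = refl
    w-inj {0F}          {1F}          eq = contradiction eq p≢q
    w-inj {1F}          {0F}          eq = contradiction (sym eq) p≢q
    w-inj {0F}          {suc (suc j)} eq = ⊥-elim (≢-by-neighbour (proj₁ (f∼pq j)) (Adj-irrefl G) (sym eq))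
    w-inj {1F}          {suc (suc j)} eq = ⊥-elim (≢-by-neighbour (proj₂ (f∼pq j)) (Adj-irrefl G) (sym eq))
    w-inj {suc (suc i)} {0F}          eq = ⊥-elim (≢-by-neighbour (proj₁ (f∼pq i)) (Adj-irrefl G) eq)
    w-inj {suc (suc i)} {1F}          eq = ⊥-elim (≢-by-neighbour (proj₂ (f∼pq i)) (Adj-irrefl G) eq)
    w-inj {suc (suc i)} {suc (suc j)} eq = cong (λ i → suc (suc i)) (f-inj eq)

  independent-common-neighbours-< : ∀ {t} → G Free K2 t → ∀ {p q : V} → p ≢ q → ¬ Adj G p q →
    ∀ J → Independent G J → (∀ {x} → x ∈ J → Adj G x p × Adj G x q) → ∣ J ∣ < t
  independent-common-neighbours-< {t} K2-free p≢q p≁q J J-indep J∼pq with t ≤? ∣ J ∣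
  ... | no  t≰∣J∣ = ≰⇒> t≰∣J∣
  ... | yes t≤∣J∣ with f , f-inj , f∈J ← t≤∣p∣⇒embedding t J t≤∣J∣ =
    contradiction (K2-copy f p≢q p≁q f-inj (J∼pq ∘ f∈J) (λ i j → J-indep _ _ (f∈J i) (f∈J j))) K2-free

  module _ {U P : Pred V ℓ} (U? : Decidable U) (crossing : ∀ {u w} → Adj G u w → U u → ¬ U w → P u ⊎ P w) where

    chain-leaving-U-hits-P : ∀ {u xs v} → Chain G (u ∷ xs) → last (u ∷ xs) ≡ just v → U u → ¬ U v → Any P (u ∷ xs)
    chain-leaving-U-hits-P [ u ]                 eq Uu ¬Uv = contradiction (subst U (just-injective eq) Uu) ¬Uv
    chain-leaving-U-hits-P (_∷_ {y = w} uw chain) eq Uu ¬Uv with U? w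
    ... | yes Uw = there (chain-leaving-U-hits-P chain eq Uw ¬Uv)
    ... | no ¬Uw = [ here , (λ Pw → there (here Pw)) ]′ (crossing uw Uu ¬Uw)

record InducedP6 (G : Graph) : Set where
  field
    w0 w1 w2 w3 w4 w5 : Vtx G
    e01 : Adj G w0 w1
    e12 : Adj G w1 w2
    e23 : Adj G w2 w3
    e34 : Adj G w3 w4
    e45 : Adj G w4 w5
    n02 : ¬ Adj G w0 w2
    n03 : ¬ Adj G w0 w3
    n04 : ¬ Adj G w0 w4
    n05 : ¬ Adj G w0 w5
    n13 : ¬ Adj G w1 w3
    n14 : ¬ Adj G w1 w4
    n15 : ¬ Adj G w1 w5
    n24 : ¬ Adj G w2 w4
    n25 : ¬ Adj G w2 w5
    n35 : ¬ Adj G w3 w5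

P6-distinguishing : ∀ i j → i ≢ j →
  Adj P6 i j ⊎ (∃ λ k → Adj P6 k i × ¬ Adj P6 k j) ⊎ (∃ λ k → Adj P6 k j × ¬ Adj P6 k i)
P6-distinguishing = from-yes (all? λ i → all? λ j → ¬? (i ≟ᶠ j) →-dec
  (Adj? P6 i j ⊎-dec any? (λ k → Adj? P6 k i ×-dec ¬? (Adj? P6 k j))
               ⊎-dec any? (λ k → Adj? P6 k j ×-dec ¬? (Adj? P6 k i))))

module _ {G : Graph} (path : InducedP6 G) where
  open InducedP6 path

  private
    w : Fin 6 → Vtx G
    w 0F = w0
    w 1F = w1
    w 2F = w2
    w 3F = w3
    w 4F = w4
    w 5F = w5

    _⁻¹ : ∀ {u v} → ¬ Adj G u v → ¬ Adj G v u
    (¬uv ⁻¹) vu = ¬uv (Adj-sym G vu)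

    preserve : ∀ i j → Adj P6 i j → Adj G (w i) (w j)
    preserve 0F 1F _ = e01
    preserve 1F 2F _ = e12
    preserve 2F 3F _ = e23
    preserve 3F 4F _ = e34
    preserve 4F 5F _ = e45
    preserve 1F 0F _ = Adj-sym G e01
    preserve 2F 1F _ = Adj-sym G e12
    preserve 3F 2F _ = Adj-sym G e23
    preserve 4F 3F _ = Adj-sym G e34
    preserve 5F 4F _ = Adj-sym G e45
    preserve 0F 0F ()
    preserve 1F 1F ()
    preserve 2F 2F ()
    preserve 3F 3F ()
    preserve 4F 4F ()
    preserve 5F 5F ()
    preserve 0F (suc (suc _)) ()
    preserve 1F (suc (suc (suc _))) ()
    preserve 2F (suc (suc (suc (suc _)))) ()
    preserve 3F 5F ()
    preserve 2F 0F ()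
    preserve 3F 0F ()
    preserve 3F 1F ()
    preserve 4F 0F ()
    preserve 4F 1F ()
    preserve 4F 2F ()
    preserve 5F 0F ()
    preserve 5F 1F ()
    preserve 5F 2F ()
    preserve 5F 3F ()

    reflect : ∀ i j → Adj G (w i) (w j) → Adj P6 i j
    reflect 0F 1F _ = refl
    reflect 1F 2F _ = refl
    reflect 2F 3F _ = refl
    reflect 3F 4F _ = refl
    reflect 4F 5F _ = refl
    reflect 1F 0F _ = refl
    reflect 2F 1F _ = refl
    reflect 3F 2F _ = refl
    reflect 4F 3F _ = refl
    reflect 5F 4F _ = refl
    reflect 0F 0F h = contradiction h (Adj-irrefl G)
    reflect 1F 1F h = contradiction h (Adj-irrefl G)
    reflect 2F 2F h = contradiction h (Adj-irrefl G)
    reflect 3F 3F h = contradiction h (Adj-irrefl G)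
    reflect 4F 4F h = contradiction h (Adj-irrefl G)
    reflect 5F 5F h = contradiction h (Adj-irrefl G)
    reflect 0F 2F h = contradiction h n02
    reflect 0F 3F h = contradiction h n03
    reflect 0F 4F h = contradiction h n04
    reflect 0F 5F h = contradiction h n05
    reflect 1F 3F h = contradiction h n13
    reflect 1F 4F h = contradiction h n14
    reflect 1F 5F h = contradiction h n15
    reflect 2F 4F h = contradiction h n24
    reflect 2F 5F h = contradiction h n25
    reflect 3F 5F h = contradiction h n35
    reflect 2F 0F h = contradiction h (n02 ⁻¹)
    reflect 3F 0F h = contradiction h (n03 ⁻¹)
    reflect 4F 0F h = contradiction h (n04 ⁻¹)
    reflect 5F 0F h = contradiction h (n05 ⁻¹)
    reflect 3F 1F h = contradiction h (n13 ⁻¹)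
    reflect 4F 1F h = contradiction h (n14 ⁻¹)
    reflect 5F 1F h = contradiction h (n15 ⁻¹)
    reflect 4F 2F h = contradiction h (n24 ⁻¹)
    reflect 5F 2F h = contradiction h (n25 ⁻¹)
    reflect 5F 3F h = contradiction h (n35 ⁻¹)

    w-inj : Injective _≡_ _≡_ w
    w-inj {i} {j} eq with i ≟ᶠ j
    ... | yes i≡j = i≡j
    ... | no  i≢j with P6-distinguishing i j i≢j
    ...   | inj₁ ij                   = contradiction (subst (Adj G (w i)) (sym eq) (preserve i j ij)) (Adj-irrefl G)
    ...   | inj₂ (inj₁ (k , ki , ¬kj)) = contradiction (reflect k j (subst (Adj G (w k)) eq (preserve k i ki))) ¬kj
    ...   | inj₂ (inj₂ (k , kj , ¬ki)) = contradiction (reflect k i (subst (Adj G (w k)) (sym eq) (preserve k j kj))) ¬ki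

  InducedP6⇒copy : InducedCopy P6 G
  InducedP6⇒copy = record { emb = w ; inj = w-inj ; adj⇔ = λ i j → preserve i j , reflect i j }

-- Neighbourhoods of a simplicial pyramid in a P6-free graph

others : (j : Fin 3) → Σ (Fin 3) λ k → Σ (Fin 3) λ l → j ≢ k × j ≢ l × k ≢ l
others 0F = 1F , 2F , (λ ()) , (λ ()) , (λ ())
others 1F = 0F , 2F , (λ ()) , (λ ()) , (λ ())
others 2F = 0F , 1F , (λ ()) , (λ ()) , (λ ())

module SimplicialPyramid (G : Graph) (P6-free : G Free P6)
                         (Π : InducedCopy Pyramid G) (simplicial : Simplicial G Π) where

  V : Set
  V = Vtx G

  px py : Fin 3 → Fin 7
  px j = suc (j ↑ˡ 3)
  py j = suc (3 ↑ʳ j)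

  a : V
  a = apex Π

  x y : Fin 3 → V
  x j = emb Π (px j)
  y j = emb Π (py j)

  private
    edge : ∀ {i j} → Adj Pyramid i j → Adj G (emb Π i) (emb Π j)
    edge = proj₁ (adj⇔ Π _ _)

    non-edge : ∀ {i j} → ¬ Adj Pyramid i j → ¬ Adj G (emb Π i) (emb Π j)
    non-edge ¬e = ¬e ∘ proj₂ (adj⇔ Π _ _)

  a∼x : ∀ j → Adj G a (x j)
  a∼x j = edge (from-yes (all? λ j → Adj? Pyramid 0F (px j)) j)

  a≁y : ∀ j → ¬ Adj G a (y j)
  a≁y j = non-edge (from-yes (all? λ j → ¬? (Adj? Pyramid 0F (py j))) j)

  x∼y : ∀ j → Adj G (x j) (y j)
  x∼y j = edge (from-yes (all? λ j → Adj? Pyramid (px j) (py j)) j)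

  x≁x : ∀ j k → j ≢ k → ¬ Adj G (x j) (x k)
  x≁x j k j≢k = non-edge (from-yes (all? λ j → all? λ k → ¬? (j ≟ᶠ k) →-dec ¬? (Adj? Pyramid (px j) (px k))) j k j≢k)

  x≁y : ∀ j k → j ≢ k → ¬ Adj G (x j) (y k)
  x≁y j k j≢k = non-edge (from-yes (all? λ j → all? λ k → ¬? (j ≟ᶠ k) →-dec ¬? (Adj? Pyramid (px j) (py k))) j k j≢k)

  y∼y : ∀ j k → j ≢ k → Adj G (y j) (y k)
  y∼y j k j≢k = edge (from-yes (all? λ j → all? λ k → ¬? (j ≟ᶠ k) →-dec Adj? Pyramid (py j) (py k)) j k j≢k)

  pyramid-vertex : ∀ i → emb Π i ≡ a ⊎ (∃ λ j → emb Π i ≡ x j) ⊎ (∃ λ j → emb Π i ≡ y j)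
  pyramid-vertex 0F = inj₁ refl
  pyramid-vertex 1F = inj₂ (inj₁ (0F , refl))
  pyramid-vertex 2F = inj₂ (inj₁ (1F , refl))
  pyramid-vertex 3F = inj₂ (inj₁ (2F , refl))
  pyramid-vertex 4F = inj₂ (inj₂ (0F , refl))
  pyramid-vertex 5F = inj₂ (inj₂ (1F , refl))
  pyramid-vertex 6F = inj₂ (inj₂ (2F , refl))

  a≢y : ∀ j → a ≢ y j
  a≢y j eq with () ← inj Π eq

  x≢y : ∀ j k → x j ≢ y k
  x≢y j k = ≢-by-neighbour {G = G} (Adj-sym G (a∼x j)) (a≁y k ∘ Adj-sym G)

  x≢x : ∀ j k → j ≢ k → x j ≢ x k
  x≢x j k j≢k = ≢-by-neighbour {G = G} (x∼y j) (x≁y k j (j≢k ∘ sym))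

  Outside : V → Set
  Outside v = ¬ InPyr Π v

  InPyr? : Decidable (InPyr Π)
  InPyr? v = any? λ i → emb Π i ≟ᶠ v

  Outside? : Decidable Outside
  Outside? = ¬? ∘ InPyr?

  clique : ∀ {v i j} → Outside v → Adj G v (emb Π i) → Adj G v (emb Π j) →
    emb Π i ≢ emb Π j → Adj G (emb Π i) (emb Π j)
  clique {v} {i} {j} out vi vj ne = proj₂ (simplicial v out) i j vi vj (ne ∘ cong (emb Π))

  ApexNeighbour : V → Set
  ApexNeighbour v = Outside v × Adj G v a

  SecondNeighbour : V → Set
  SecondNeighbour c = Outside c × ¬ Adj G c a × ∃ λ v → ApexNeighbour v × Adj G v c

  no-induced-P6 : ¬ InducedP6 G
  no-induced-P6 = P6-free ∘ InducedP6⇒copy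

  apexNeighbour-≁-y : ∀ {v} → ApexNeighbour v → ∀ j → ¬ Adj G v (y j)
  apexNeighbour-≁-y (out , va) j vy = a≁y j (clique out va vy (a≢y j))

  outside-neighbour : ∀ {v} → Outside v → Adj G v a ⊎ (∃ λ j → Adj G v (x j)) ⊎ (∃ λ j → Adj G v (y j))
  outside-neighbour {v} out with i , vi ← proj₁ (simplicial v out) with pyramid-vertex i
  ... | inj₁ eq              = inj₁ (subst (Adj G v) eq vi)
  ... | inj₂ (inj₁ (j , eq)) = inj₂ (inj₁ (j , subst (Adj G v) eq vi))
  ... | inj₂ (inj₂ (j , eq)) = inj₂ (inj₂ (j , subst (Adj G v) eq vi))

  outside-≁-two-x : ∀ {v} → Outside v → ∀ j k → j ≢ k → Adj G v (x j) → ¬ Adj G v (x k)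
  outside-≁-two-x out j k j≢k vxj vxk = x≁x j k j≢k (clique out vxj vxk (x≢x j k j≢k))

  module _ {c} (c-out : Outside c) (c≁a : ¬ Adj G c a) where

    adj-y⇒¬¬adj-y : ∀ {j k l} → j ≢ k → j ≢ l → k ≢ l → Adj G c (y k) → ¬ ¬ Adj G c (y j)
    adj-y⇒¬¬adj-y {j} {k} {l} j≢k j≢l k≢l cyk c≁yj = no-induced-P6 record
      { w0 = c ; w1 = y k ; w2 = y j ; w3 = x j ; w4 = a ; w5 = x l
      ; e01 = cyk ; e12 = y∼y k j (j≢k ∘ sym) ; e23 = Adj-sym G (x∼y j) ; e34 = Adj-sym G (a∼x j) ; e45 = a∼x l
      ; n02 = c≁yj
      ; n03 = λ cxj → x≁y j k j≢k (clique c-out cxj cyk (x≢y j k))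
      ; n04 = c≁a
      ; n05 = λ cxl → x≁y l k (k≢l ∘ sym) (clique c-out cxl cyk (x≢y l k))
      ; n13 = x≁y j k j≢k ∘ Adj-sym G
      ; n14 = a≁y k ∘ Adj-sym G
      ; n15 = x≁y l k (k≢l ∘ sym) ∘ Adj-sym G
      ; n24 = a≁y j ∘ Adj-sym G
      ; n25 = x≁y l j (j≢l ∘ sym) ∘ Adj-sym G
      ; n35 = x≁x j l j≢l }

    ≁y₀⇒≁y : ¬ Adj G c (y 0F) → ∀ k → ¬ Adj G c (y k)
    ≁y₀⇒≁y c≁y₀ 0F     = c≁y₀
    ≁y₀⇒≁y c≁y₀ 1F cy₁ = adj-y⇒¬¬adj-y {0F} {1F} {2F} (λ ()) (λ ()) (λ ()) cy₁ c≁y₀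
    ≁y₀⇒≁y c≁y₀ 2F cy₂ = adj-y⇒¬¬adj-y {0F} {2F} {1F} (λ ()) (λ ()) (λ ()) cy₂ c≁y₀

    module _ {v} (v-apex : ApexNeighbour v) (vc : Adj G v c) {j} (cxj : Adj G c (x j)) where
      private
        v-out : Outside v
        v-out = proj₁ v-apex
        va : Adj G v a
        va = proj₂ v-apex

        via-apex : (∀ k → ¬ Adj G c (y k)) → ∀ {k} → j ≢ k → ¬ Adj G v (x j)
        via-apex c≁y {k} j≢k vxj = no-induced-P6 record
          { w0 = c ; w1 = v ; w2 = a ; w3 = x k ; w4 = y k ; w5 = y j
          ; e01 = Adj-sym G vc ; e12 = va ; e23 = a∼x k ; e34 = x∼y k ; e45 = y∼y k j (j≢k ∘ sym)
          ; n02 = c≁a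
          ; n03 = λ cxk → x≁x j k j≢k (clique c-out cxj cxk (x≢x j k j≢k))
          ; n04 = c≁y k ; n05 = c≁y j
          ; n13 = outside-≁-two-x v-out j k j≢k vxj
          ; n14 = apexNeighbour-≁-y v-apex k ; n15 = apexNeighbour-≁-y v-apex j
          ; n24 = a≁y k ; n25 = a≁y j
          ; n35 = x≁y k j (j≢k ∘ sym) }

        via-base : (∀ k → ¬ Adj G c (y k)) → ∀ {k} → j ≢ k → ¬ Adj G v (x j) → ¬ ¬ Adj G v (x k)
        via-base c≁y {k} j≢k v≁xj v≁xk = no-induced-P6 record
          { w0 = v ; w1 = c ; w2 = x j ; w3 = y j ; w4 = y k ; w5 = x k
          ; e01 = vc ; e12 = cxj ; e23 = x∼y j ; e34 = y∼y j k j≢k ; e45 = Adj-sym G (x∼y k)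
          ; n02 = v≁xj ; n03 = apexNeighbour-≁-y v-apex j ; n04 = apexNeighbour-≁-y v-apex k ; n05 = v≁xk
          ; n13 = c≁y j ; n14 = c≁y k
          ; n15 = λ cxk → x≁x j k j≢k (clique c-out cxj cxk (x≢x j k j≢k))
          ; n24 = x≁y j k j≢k ; n25 = x≁x j k j≢k
          ; n35 = x≁y k j (j≢k ∘ sym) ∘ Adj-sym G }

      x-neighbour-sees-y : ¬ (∀ k → ¬ Adj G c (y k))
      x-neighbour-sees-y c≁y with others j
      ... | k , l , j≢k , j≢l , k≢l with Adj? G v (x k)
      ...   | yes vxk = via-base c≁y j≢l (via-apex c≁y j≢k) (outside-≁-two-x v-out k l k≢l vxk)
      ...   | no  v≁xk = via-base c≁y j≢k (via-apex c≁y j≢k) v≁xk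

  secondNeighbour-∼-y₀ : ∀ {c} → SecondNeighbour c → Adj G c (y 0F)
  secondNeighbour-∼-y₀ {c} (c-out , c≁a , v , v-apex , vc) = decidable-stable (Adj? G c (y 0F)) λ c≁y₀ →
    let c≁y = ≁y₀⇒≁y c-out c≁a c≁y₀ in
    [ c≁a , [ (λ (j , cxj) → x-neighbour-sees-y c-out c≁a v-apex vc cxj c≁y) , (λ (k , cyk) → c≁y k cyk) ]′ ]′
      (outside-neighbour c-out)

  apexNeighbour-∼-secondNeighbours : ∀ {v c c'} → ApexNeighbour v → Adj G v c →
    SecondNeighbour c → SecondNeighbour c' → ¬ Adj G c c' → Adj G v c'
  apexNeighbour-∼-secondNeighbours {v} {c} {c'} v-apex@(v-out , va) vc
    c-second@(c-out , c≁a , _) c'-second@(c'-out , c'≁a , _) c≁c' =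
    decidable-stable (Adj? G v c') λ v≁c' → case Adj? G v (x 1F) of λ where
      (yes vx₁) → via (λ ()) (outside-≁-two-x v-out 1F 2F (λ ()) vx₁) v≁c'
      (no v≁x₁) → via (λ ()) v≁x₁ v≁c'
    where
    cy₀ : Adj G c (y 0F)
    cy₀ = secondNeighbour-∼-y₀ c-second
    c'y₀ : Adj G c' (y 0F)
    c'y₀ = secondNeighbour-∼-y₀ c'-second
    via : ∀ {k} → k ≢ 0F → ¬ Adj G v (x k) → ¬ ¬ Adj G v c'
    via {k} k≢0 v≁xk v≁c' = no-induced-P6 record
      { w0 = x k ; w1 = a ; w2 = v ; w3 = c ; w4 = y 0F ; w5 = c'
      ; e01 = Adj-sym G (a∼x k) ; e12 = Adj-sym G va ; e23 = vc ; e34 = cy₀ ; e45 = Adj-sym G c'y₀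
      ; n02 = v≁xk ∘ Adj-sym G
      ; n03 = λ xc → x≁y k 0F k≢0 (clique c-out (Adj-sym G xc) cy₀ (x≢y k 0F))
      ; n04 = x≁y k 0F k≢0
      ; n05 = λ xc' → x≁y k 0F k≢0 (clique c'-out (Adj-sym G xc') c'y₀ (x≢y k 0F))
      ; n13 = c≁a ∘ Adj-sym G ; n14 = a≁y 0F ; n15 = c'≁a ∘ Adj-sym G
      ; n24 = apexNeighbour-≁-y v-apex 0F ; n25 = v≁c' ; n35 = c≁c' }

  module Separation (b : V) (basic : Basic G Π b) where

    b-out : Outside b
    b-out = proj₁ basic

    b≁a : ¬ Adj G b a
    b≁a ba with () ← proj₁ (proj₂ basic 0F) ba

    a≢b : a ≢ b
    a≢b eq = b-out (0F , eq)

    X : Subset (n G)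
    X = ⁅ x 0F ⁆ ∪ ⁅ x 1F ⁆ ∪ ⁅ x 2F ⁆

    InR : V → Set
    InR w = Adj G w a × Adj G w b

    InR? : Decidable InR
    InR? w = Adj? G w a ×-dec Adj? G w b

    R : Subset (n G)
    R = fromDec InR?

    InQ : V → Set
    InQ w = w ≢ b × SecondNeighbour w

    InQ? : Decidable InQ
    InQ? w = ¬? (w ≟ᶠ b) ×-dec Outside? w ×-dec ¬? (Adj? G w a) ×-dec
             any? λ v → (Outside? v ×-dec Adj? G v a) ×-dec Adj? G v w

    Q : Subset (n G)
    Q = fromDec InQ?

    S : Subset (n G)
    S = X ∪ R ∪ Q

    x∈S : ∀ j → x j ∈ S
    x∈S j = x∈p∪q⁺ (inj₁ (x∈X j))
      where
      x∈X : ∀ j → x j ∈ X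
      x∈X 0F = x∈p∪q⁺ (inj₁ (x∈⁅x⁆ _))
      x∈X 1F = x∈p∪q⁺ (inj₂ (x∈p∪q⁺ (inj₁ (x∈⁅x⁆ _))))
      x∈X 2F = x∈p∪q⁺ (inj₂ (x∈p∪q⁺ (inj₂ (x∈⁅x⁆ _))))

    R⊆S : ∀ {w} → InR w → w ∈ S
    R⊆S w∈R = x∈p∪q⁺ (inj₂ (x∈p∪q⁺ (inj₁ (∈-fromDec⁺ InR? w∈R))))

    Q⊆S : ∀ {w} → InQ w → w ∈ S
    Q⊆S w∈Q = x∈p∪q⁺ (inj₂ (x∈p∪q⁺ (inj₂ (∈-fromDec⁺ InQ? w∈Q))))

    ∈S⁻ : ∀ {w} → w ∈ S → (∃ λ j → w ≡ x j) ⊎ InR w ⊎ InQ w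
    ∈S⁻ {w} w∈S with x∈p∪q⁻ X (R ∪ Q) w∈S
    ... | inj₂ w∈R∪Q = inj₂ (Sum.map (∈-fromDec⁻ InR?) (∈-fromDec⁻ InQ?) (x∈p∪q⁻ R Q w∈R∪Q))
    ... | inj₁ w∈X with x∈p∪q⁻ ⁅ x 0F ⁆ _ w∈X
    ...   | inj₁ w∈x₀ = inj₁ (0F , x∈⁅y⁆⇒x≡y _ w∈x₀)
    ...   | inj₂ w∈x₁₂ = inj₁ ([ (λ w∈x₁ → 1F , x∈⁅y⁆⇒x≡y _ w∈x₁) , (λ w∈x₂ → 2F , x∈⁅y⁆⇒x≡y _ w∈x₂) ]′
                               (x∈p∪q⁻ ⁅ x 1F ⁆ _ w∈x₁₂))

    a∉S : a ∉ S
    a∉S a∈S with ∈S⁻ a∈S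
    ... | inj₁ (j , a≡xj)       = Adj-irrefl G (subst (Adj G a) (sym a≡xj) (a∼x j))
    ... | inj₂ (inj₁ (aa , _))  = Adj-irrefl G aa
    ... | inj₂ (inj₂ (_ , a-out , _)) = a-out (0F , refl)

    b∉S : b ∉ S
    b∉S b∈S with ∈S⁻ b∈S
    ... | inj₁ (j , b≡xj)       = b-out (px j , sym b≡xj)
    ... | inj₂ (inj₁ (_ , bb))  = Adj-irrefl G bb
    ... | inj₂ (inj₂ (b≢b , _)) = b≢b refl

    ClosedNbhd : V → Set
    ClosedNbhd w = w ≡ a ⊎ Adj G w a

    ClosedNbhd? : Decidable ClosedNbhd
    ClosedNbhd? w = (w ≟ᶠ a) ⊎-dec Adj? G w a

    leaving-ClosedNbhd-hits-S : ∀ {u w} → Adj G u w → ClosedNbhd u → ¬ ClosedNbhd w → u ∈ S ⊎ w ∈ S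
    leaving-ClosedNbhd-hits-S uw (inj₁ refl) w∉N = contradiction (inj₂ (Adj-sym G uw)) w∉N
    leaving-ClosedNbhd-hits-S {u} {w} uw (inj₂ ua) w∉N with InPyr? u
    ... | yes (i , refl) with pyramid-vertex i
    ...   | inj₁ eq              = contradiction (subst (λ v → Adj G v a) eq ua) (Adj-irrefl G)
    ...   | inj₂ (inj₁ (j , eq)) = inj₁ (subst (_∈ S) (sym eq) (x∈S j))
    ...   | inj₂ (inj₂ (j , eq)) = contradiction (Adj-sym G (subst (λ v → Adj G v a) eq ua)) (a≁y j)
    leaving-ClosedNbhd-hits-S {u} {w} uw (inj₂ ua) w∉N | no u-out with w ≟ᶠ b
    ... | yes refl = inj₁ (R⊆S (ua , uw))
    ... | no  w≢b  = inj₂ (Q⊆S (w≢b , w-out , w∉N ∘ inj₂ , u , (u-out , ua) , uw))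
      where
      w-out : Outside w
      w-out (i , refl) = w∉N (inj₂ (Adj-sym G (clique u-out ua uw (w∉N ∘ inj₁ ∘ sym))))

    separates : Separator G a b S
    separates = a∉S , b∉S , every-path-hits-S
      where
      every-path-hits-S : (P : Path G a b) → Any (_∈ S) (verts P)
      every-path-hits-S P with verts P | chain P | start P | end P
      ... | u ∷ _ | ch | st | en with refl ← just-injective st =
        chain-leaving-U-hits-P ClosedNbhd? leaving-ClosedNbhd-hits-S ch en (inj₁ refl) [ a≢b ∘ sym , b≁a ]′

    module _ {t} (t≥1 : 1 ≤ t) (K2-free : G Free K2 t) where

      independent-R-< : ∀ J → J ⊆ R → Independent G J → ∣ J ∣ < t
      independent-R-< J J⊆R J-indep =
        independent-common-neighbours-< K2-free a≢b (b≁a ∘ Adj-sym G) J J-indep (∈-fromDec⁻ InR? ∘ J⊆R)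

      independent-Q-< : ∀ J → J ⊆ Q → Independent G J → ∣ J ∣ < t
      independent-Q-< J J⊆Q J-indep with nonempty? J
      ... | no  J-empty = subst (_< t) (sym (trans (cong ∣_∣ (Empty-unique J-empty)) (∣⊥∣≡0 (n G)))) t≥1
      ... | yes (c , c∈J) with _ , c-second@(_ , _ , v , v-apex , vc) ← ∈-fromDec⁻ InQ? (J⊆Q c∈J) =
        independent-common-neighbours-< K2-free (λ eq → proj₁ v-apex (py 0F , sym eq)) (apexNeighbour-≁-y v-apex 0F)
          J J-indep λ c'∈J → let c'-second = proj₂ (∈-fromDec⁻ InQ? (J⊆Q c'∈J)) in
            Adj-sym G (apexNeighbour-∼-secondNeighbours v-apex vc c-second c'-second (J-indep _ _ c∈J c'∈J)) ,
            secondNeighbour-∼-y₀ c'-second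

      α-bound : αLe G S (2 * (t ∸ 1) + 3)
      α-bound I I⊆S I-indep = begin
        ∣ I ∣                                  ≤⟨ ⊆∪⇒∣p∣≤∣p∩q∣+∣p∩r∣ I X (R ∪ Q) I⊆S ⟩
        ∣ I ∩ X ∣ + ∣ I′ ∣                       ≤⟨ +-mono-≤ (∣p∩q∣≤∣q∣ I X) (⊆∪⇒∣p∣≤∣p∩q∣+∣p∩r∣ I′ R Q (p∩q⊆q I (R ∪ Q))) ⟩
        ∣ X ∣ + (∣ I′ ∩ R ∣ + ∣ I′ ∩ Q ∣)        ≤⟨ +-mono-≤ ∣X∣≤3 (+-mono-≤ (part R independent-R-<) (part Q independent-Q-<)) ⟩
        3 + ((t ∸ 1) + (t ∸ 1))               ≡⟨ +-comm 3 _ ⟩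
        (t ∸ 1) + (t ∸ 1) + 3                 ≡⟨ cong (λ k → (t ∸ 1) + k + 3) (sym (+-identityʳ (t ∸ 1))) ⟩
        2 * (t ∸ 1) + 3                       ∎
        where
        open ≤-Reasoning
        I′ : Subset (n G)
        I′ = I ∩ (R ∪ Q)
        ∣X∣≤3 : ∣ X ∣ ≤ 3
        ∣X∣≤3 = begin
          ∣ X ∣                                       ≤⟨ ∣p∪q∣≤∣p∣+∣q∣ ⁅ x 0F ⁆ _ ⟩
          ∣ ⁅ x 0F ⁆ ∣ + ∣ ⁅ x 1F ⁆ ∪ ⁅ x 2F ⁆ ∣       ≤⟨ +-monoʳ-≤ ∣ ⁅ x 0F ⁆ ∣ (∣p∪q∣≤∣p∣+∣q∣ ⁅ x 1F ⁆ _) ⟩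
          ∣ ⁅ x 0F ⁆ ∣ + (∣ ⁅ x 1F ⁆ ∣ + ∣ ⁅ x 2F ⁆ ∣) ≡⟨ cong₂ _+_ (∣⁅x⁆∣≡1 (x 0F)) (cong₂ _+_ (∣⁅x⁆∣≡1 (x 1F)) (∣⁅x⁆∣≡1 (x 2F))) ⟩
          3                                           ∎
        part : ∀ T → (∀ J → J ⊆ T → Independent G J → ∣ J ∣ < t) → ∣ I′ ∩ T ∣ ≤ t ∸ 1
        part T bound = <⇒≤pred (bound (I′ ∩ T) (p∩q⊆q I′ T) (Independent-⊆ {G = G} (p∩q⊆p I (R ∪ Q) ∘ p∩q⊆p I′ T) I-indep))

lemma4p2 : (t : ℕ) → 3 ≤ t → (G : Graph) → G Free P6 → G Free K2 t →
    (Π : InducedCopy Pyramid G) → Simplicial G Π →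
    (b : Vtx G) → Basic G Π b →
    Σ (Subset (n G)) (λ S → Separator G (apex Π) b S × αLe G S (2 * (t ∸ 1) + 3))
lemma4p2 t 3≤t G P6-free K2-free Π simplicial b basic =
  S , separates , α-bound (≤-trans (s≤s z≤n) 3≤t) K2-free
  where
  open SimplicialPyramid G P6-free Π simplicial
  open Separation b basic
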